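{- Let $G=(V,E)$ be a digraph and $K,Z\subseteq V$ be such that $K$ is $Z$-normal. Then for each path $\mathfrak{p}=(V_{\mathfrak{p}},E_{\mathfrak{p}})$ in $G$, $|E_{\mathfrak{p}}\cap E(K,V\setminus K)|\le 2\cdot|Z|+2$.
   Context: For disjoint $Z,K\subseteq V$, $K$ is $Z$-normal if there is no directed walk in $V\setminus Z$ with first and last vertex in $K$ that uses a vertex of $V\setminus(Z\cup K)$. A path is a directed simple path $v_1e_1\dots e_{n-1}v_n$ ($e_i$ from $v_i$ to $v_{i+1}$, pairwise distinct vertices) with vertex set $V_{\mathfrak{p}}$ and edge set $E_{\mathfrak{p}}$. For disjoint $V_1,V_2$, $E(V_1,V_2)$ is the set of edges with one endpoint in $V_1$ and the other in $V_2$. -}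

module Defs where

open import Data.Nat using (ℕ; zero; suc; _+_)
open import Data.Bool using (Bool; true; false; _xor_)
open import Data.Fin using (Fin)
open import Data.Fin.Subset using (Subset; _∈_; _∉_)
open import Data.Vec using (lookup)
open import Data.List using (List; []; _∷_)
open import Data.List.Relation.Unary.All using (All)
open import Data.List.Relation.Unary.Any using (Any)
open import Data.List.Relation.Unary.Unique.Propositional using (Unique)
open import Data.Product using (Σ; _×_; ∃)
open import Relation.Nullary using (¬_)

record Digraph : Set₁ where
  field
    n   : ℕ
    Adj : Fin n → Fin n → Set
open Digraph public

data Walk (G : Digraph) : Fin (n G) → Fin (n G) → Set where
  []  : ∀ {v} → Walk G v v
  _∷_ : ∀ {u v w} → Adj G u v → Walk G v w → Walk G u w

vertices : ∀ {G u w} → Walk G u w → List (Fin (n G))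
vertices {u = u} []       = u ∷ []
vertices {u = u} (e ∷ p)  = u ∷ vertices p

IsPath : ∀ {G u w} → Walk G u w → Set
IsPath p = Unique (vertices p)

IsNormal : (G : Digraph) → (Z K : Subset (n G)) → Set
IsNormal G Z K =
  ∀ {a b} (p : Walk G a b) → a ∈ K → b ∈ K →
    All (λ v → v ∉ Z) (vertices p) →
    ¬ Any (λ v → v ∉ Z × v ∉ K) (vertices p)

-- |E_p ∩ E(K, V \ K)|: the number of edges of the walk with exactly one
-- endpoint in K.  (For a path, the edges are pairwise distinct.)
crossing : ∀ {G u w} → Subset (n G) → Walk G u w → ℕ
crossing K [] = 0
crossing {u = u} K (_∷_ {v = v} e p) with lookup K u xor lookup K v
... | true  = suc (crossing K p)
... | false = crossing K p

module Submission where

-- Follow the path through three states: in K, outside K, and stranded (outside K and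
-- Z, with no Z-avoiding way back into K).  By normality, an exit from K to a vertex
-- outside Z strands the walk until it meets Z; hence every Z-vertex after the start
-- pays for at most two crossings, and the vertices of a path are distinct.

open import Defs
open import Data.Nat using (ℕ; _≤_; _+_; _*_; z≤n; s≤s)
open import Data.Nat.Properties
  using (≤-trans; m≤n+m; m≤n⇒m≤1+n; +-monoʳ-≤; *-monoʳ-≤; *-suc; +-comm; module ≤-Reasoning)
open import Data.Fin using (Fin)
open import Data.Fin.Subset using (Subset; _∈_; _∉_; _∩_; _-_; Empty; ∣_∣)
open import Data.Fin.Subset.Properties using (_∈?_; x∈p∩q⁺; x∈p∧x≢y⇒x∈p-y; x∈p⇒∣p-x∣<∣p∣)
open import Data.Vec using (lookup)
open import Data.Vec.Properties using (lookup⇒[]=; []=⇒lookup)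
open import Data.List using (List; []; _∷_; length; filter)
open import Data.List.Relation.Unary.All as All using (All; []; _∷_)
open import Data.List.Relation.Unary.All.Properties using (all-filter)
open import Data.List.Relation.Unary.Any using (Any; here; there)
open import Data.List.Relation.Unary.AllPairs using ([]; _∷_)
open import Data.List.Relation.Unary.Unique.Propositional using (Unique)
open import Data.List.Relation.Unary.Unique.Propositional.Properties using (filter⁺)
open import Data.Bool using (true; false)
open import Data.Product using (_,_)
open import Relation.Nullary using (¬_; yes; no; contradiction)
open import Relation.Binary.PropositionalEquality using (_≡_; refl; cong; subst; sym; trans; ≢-sym)

length≤∣∣ : ∀ {m} {p : Subset m} {xs : List (Fin m)} →
  Unique xs → All (_∈ p) xs → length xs ≤ ∣ p ∣
length≤∣∣ [] [] = z≤n
length≤∣∣ {p = p} {x ∷ xs} (x∉xs ∷ xs-unique) (x∈p ∷ xs⊆p) =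
  ≤-trans (s≤s (length≤∣∣ xs-unique xs⊆p-x)) (x∈p⇒∣p-x∣<∣p∣ x∈p)
  where
  xs⊆p-x : All (_∈ p - x) xs
  xs⊆p-x = All.zipWith (λ (y∈p , x≢y) → x∈p∧x≢y⇒x∈p-y y∈p (≢-sym x≢y)) (xs⊆p , x∉xs)

lookup≡false⇒∉ : ∀ {m} {p : Subset m} {x : Fin m} → lookup p x ≡ false → x ∉ p
lookup≡false⇒∉ p[x]≡false x∈p with trans (sym ([]=⇒lookup x∈p)) p[x]≡false
... | ()

countIn : ∀ {m} → Subset m → List (Fin m) → ℕ
countIn p xs = length (filter (_∈? p) xs)

countIn≤∣∣ : ∀ {m} {p : Subset m} {xs : List (Fin m)} → Unique xs → countIn p xs ≤ ∣ p ∣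
countIn≤∣∣ {p = p} {xs} xs-unique = length≤∣∣ (filter⁺ (_∈? p) xs-unique) (all-filter (_∈? p) xs)

tailVertices : ∀ {G u w} → Walk G u w → List (Fin (n G))
tailVertices []                = []
tailVertices (_∷_ {v = v} _ p) = v ∷ tailVertices p

vertices≡∷tailVertices : ∀ {G u w} (p : Walk G u w) → vertices p ≡ u ∷ tailVertices p
vertices≡∷tailVertices []      = refl
vertices≡∷tailVertices {u = u} (_ ∷ p) = cong (u ∷_) (vertices≡∷tailVertices p)

Unique-tailVertices : ∀ {G u w} {p : Walk G u w} → IsPath p → Unique (tailVertices p)
Unique-tailVertices {p = p} path with subst Unique (vertices≡∷tailVertices p) path
... | _ ∷ tail-unique = tail-unique

module _ {G : Digraph} {K Z : Subset (n G)}
         (K∩Z-empty : Empty (K ∩ Z)) (normal : IsNormal G Z K) where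

  ∈K⇒∉Z : ∀ {v} → v ∈ K → v ∉ Z
  ∈K⇒∉Z v∈K v∈Z = K∩Z-empty (_ , x∈p∩q⁺ (v∈K , v∈Z))

  Stranded : Fin (n G) → Set
  Stranded u = ∀ {b} (r : Walk G u b) → b ∈ K → ¬ All (_∉ Z) (vertices r)

  stranded-after-exit : ∀ {u v} → Adj G u v → u ∈ K → v ∉ K → v ∉ Z → Stranded v
  stranded-after-exit e u∈K v∉K v∉Z r b∈K r-avoids-Z =
    normal (e ∷ r) u∈K b∈K (∈K⇒∉Z u∈K ∷ r-avoids-Z)
      (there (subst (Any _) (sym (vertices≡∷tailVertices r)) (here (v∉Z , v∉K))))

  stranded-step : ∀ {u v} → Stranded u → u ∉ Z → Adj G u v → Stranded v
  stranded-step stranded u∉Z e r b∈K r-avoids-Z = stranded (e ∷ r) b∈K (u∉Z ∷ r-avoids-Z)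

  stranded⇒∉K : ∀ {u} → u ∉ Z → Stranded u → u ∉ K
  stranded⇒∉K u∉Z stranded u∈K = stranded [] u∈K (u∉Z ∷ [])

  crossing-from-outside : ∀ {u w} (p : Walk G u w) → lookup K u ≡ false →
    crossing K p ≤ 2 + 2 * countIn Z (tailVertices p)
  crossing-from-inside : ∀ {u w} (p : Walk G u w) → lookup K u ≡ true →
    crossing K p ≤ 1 + 2 * countIn Z (tailVertices p)
  crossing-from-stranded : ∀ {u w} (p : Walk G u w) → lookup K u ≡ false → u ∉ Z → Stranded u →
    crossing K p ≤ 2 * countIn Z (tailVertices p)

  crossing-from-outside [] _ = z≤n
  crossing-from-outside (_∷_ {v = v} e p) K[u] rewrite K[u] with lookup K v in K[v] | v ∈? Z
  ... | true  | yes v∈Z = contradiction v∈Z (∈K⇒∉Z (lookup⇒[]= v K K[v]))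
  ... | true  | no  _   = s≤s (crossing-from-inside p K[v])
  ... | false | no  _   = crossing-from-outside p K[v]
  ... | false | yes _
    rewrite *-suc 2 (countIn Z (tailVertices p)) =
      ≤-trans (crossing-from-outside p K[v]) (+-monoʳ-≤ 2 (m≤n+m _ 2))

  crossing-from-inside [] _ = z≤n
  crossing-from-inside (_∷_ {v = v} e p) K[u] rewrite K[u] with lookup K v in K[v] | v ∈? Z
  ... | true  | yes v∈Z = contradiction v∈Z (∈K⇒∉Z (lookup⇒[]= v K K[v]))
  ... | true  | no  _   = crossing-from-inside p K[v]
  ... | false | no  v∉Z =
    s≤s (crossing-from-stranded p K[v] v∉Z
          (stranded-after-exit e (lookup⇒[]= _ K K[u]) (lookup≡false⇒∉ K[v]) v∉Z))
  ... | false | yes _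
    rewrite *-suc 2 (countIn Z (tailVertices p)) = s≤s (crossing-from-outside p K[v])

  crossing-from-stranded [] _ _ _ = z≤n
  crossing-from-stranded (_∷_ {v = v} e p) K[u] u∉Z stranded rewrite K[u]
    with lookup K v in K[v] | v ∈? Z
  ... | true  | yes v∈Z = contradiction v∈Z (∈K⇒∉Z (lookup⇒[]= v K K[v]))
  ... | true  | no  v∉Z =
    contradiction (lookup⇒[]= v K K[v]) (stranded⇒∉K v∉Z (stranded-step stranded u∉Z e))
  ... | false | no  v∉Z = crossing-from-stranded p K[v] v∉Z (stranded-step stranded u∉Z e)
  ... | false | yes _
    rewrite *-suc 2 (countIn Z (tailVertices p)) = crossing-from-outside p K[v]

  crossing≤ : ∀ {u w} (p : Walk G u w) → crossing K p ≤ 2 + 2 * countIn Z (tailVertices p)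
  crossing≤ {u} p with lookup K u in K[u]
  ... | true  = m≤n⇒m≤1+n (crossing-from-inside p K[u])
  ... | false = crossing-from-outside p K[u]

proposition3 : (G : Digraph) (K Z : Subset (n G)) →
    Empty (K ∩ Z) → IsNormal G Z K →
    ∀ {u w} (p : Walk G u w) → IsPath p →
      crossing K p ≤ 2 * ∣ Z ∣ + 2
proposition3 G K Z K∩Z-empty normal p path = begin
  crossing K p                           ≤⟨ crossing≤ K∩Z-empty normal p ⟩
  2 + 2 * countIn Z (tailVertices p)     ≤⟨ +-monoʳ-≤ 2 (*-monoʳ-≤ 2 (countIn≤∣∣ (Unique-tailVertices path))) ⟩
  2 + 2 * ∣ Z ∣                          ≡⟨ +-comm 2 _ ⟩
  2 * ∣ Z ∣ + 2                          ∎
  where open ≤-Reasoning
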